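{- Let $i\geq 4$, let $G$ be a claw-o-heavy and $P_i$-c-heavy graph, and let $x$ be a c-eligible vertex of $G$. Then $G'_x$ is $P_i$-c-heavy.
   Context: All graphs are finite and simple. For a graph $G$ on $n=|V(G)|$ vertices, a vertex $v$ is heavy if $d_G(v)\geq n/2$; a pair $\{u,v\}$ is a heavy pair of $G$ if $uv\notin E(G)$ and $d_G(u)+d_G(v)\geq n$. $G$ is claw-o-heavy if every induced $K_{1,3}$ of $G$ contains a heavy pair of $G$. For a graph $S$, $G$ is $S$-c-heavy if for every induced subgraph $G'$ of $G$ isomorphic to $S$ and every maximal clique $C$ of $G'$, every component of $G'-C$ with at least two vertices contains a vertex heavy in $G$. $P_i$ is the path on $i$ vertices. For a vertex $x$ of $G$, $G'_x$ (the completion of $G$ at $x$) is the graph on $V(G)$ obtained from $G$ by adding all missing edges $uv$ with $u,v\in N_G(x)$; heaviness in $G'_x$ is measured by degrees in $G'_x$ with the same $n$. For a claw-o-heavy $G$ and $x\in V(G)$, let $G^*$ be the graph obtained from $G$ by adding all missing edges $uv$ with $u,v\in N_G(x)$ and $\{u,v\}$ a heavy pair of $G$. The vertex $x$ is c-eligible if $N_G(x)$ is not a clique of $G$ and either (1) $G^*[N_G(x)]$ is connected, or (2) $G^*[N_G(x)]$ consists of two disjoint cliques $C_1,C_2$ and there is a vertex $z$ such that $\{x,z\}$ is a heavy pair of $G$ and $zy_1,zy_2\in E(G)$ for some $y_1\in C_1$, $y_2\in C_2$. -}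

module Defs where

open import Data.Nat using (ℕ; zero; suc; _+_; _*_; _≤_)
open import Data.Fin using (Fin; toℕ; _≟_) renaming (zero to fzero; suc to fsuc)
open import Data.Bool using (Bool; true; false; if_then_else_; _∧_; _∨_; not)
open import Data.Product using (Σ; ∃; _×_; _,_)
open import Data.Sum using (_⊎_)
open import Data.Empty using (⊥)
open import Relation.Nullary using (¬_)
open import Relation.Nullary.Decidable using (⌊_⌋)
open import Relation.Binary.PropositionalEquality using (_≡_; _≢_)
open import Function using (_∘_; _⇔_)

Graph : ℕ → Set
Graph n = Fin n → Fin n → Bool

record IsSimple {n : ℕ} (G : Graph n) : Set where
  field
    sym     : ∀ u v → G u v ≡ G v u
    irrefl  : ∀ v → G v v ≡ false

countT : ∀ {n} → (Fin n → Bool) → ℕ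
countT {zero}  f = 0
countT {suc n} f = (if f fzero then 1 else 0) + countT (f ∘ fsuc)

deg : ∀ {n} → Graph n → Fin n → ℕ
deg G v = countT (G v)

-- v is heavy: d(v) ≥ n/2, i.e. 2 d(v) ≥ n
Heavy : ∀ {n} → Graph n → Fin n → Set
Heavy {n} G v = n ≤ 2 * deg G v

HeavyPair : ∀ {n} → Graph n → Fin n → Fin n → Set
HeavyPair {n} G u v = u ≢ v × G u v ≡ false × n ≤ deg G u + deg G v

InducedClaw : ∀ {n} → Graph n → Fin n → Fin n → Fin n → Fin n → Set
InducedClaw G c a₁ a₂ a₃ =
  a₁ ≢ a₂ × a₁ ≢ a₃ × a₂ ≢ a₃ ×
  G c a₁ ≡ true × G c a₂ ≡ true × G c a₃ ≡ true ×
  G a₁ a₂ ≡ false × G a₁ a₃ ≡ false × G a₂ a₃ ≡ false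

ClawOHeavy : ∀ {n} → Graph n → Set
ClawOHeavy G = ∀ c a₁ a₂ a₃ → InducedClaw G c a₁ a₂ a₃ →
  HeavyPair G a₁ a₂ ⊎ HeavyPair G a₁ a₃ ⊎ HeavyPair G a₂ a₃

data Reach {m : ℕ} (A : Fin m → Fin m → Bool) (T : Fin m → Bool) (u : Fin m) : Fin m → Set where
  here : T u ≡ true → Reach A T u u
  step : ∀ {v w} → Reach A T u v → A v w ≡ true → T w ≡ true → Reach A T u w

PathAdj : ∀ {i} → Fin i → Fin i → Set
PathAdj j k = suc (toℕ j) ≡ toℕ k ⊎ suc (toℕ k) ≡ toℕ j

InducedPath : ∀ {n} (i : ℕ) → Graph n → (Fin i → Fin n) → Set
InducedPath i G p = (∀ j k → p j ≡ p k → j ≡ k) × (∀ j k → (G (p j) (p k) ≡ true) ⇔ PathAdj j k)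

IsClique : ∀ {m} → (Fin m → Fin m → Bool) → (Fin m → Bool) → Set
IsClique A C = ∀ j k → C j ≡ true → C k ≡ true → j ≢ k → A j k ≡ true

IsMaximalClique : ∀ {m} → (Fin m → Fin m → Bool) → (Fin m → Bool) → Set
IsMaximalClique A C = IsClique A C ×
  (∀ k → C k ≡ false → ∃ λ j → C j ≡ true × A j k ≡ false)

-- S-c-heavy for S = P_i: for every induced P_i (G' = G[p(Fin i)], with adjacency
-- A j k = G (p j) (p k) on the indices), every maximal clique C of G', every
-- component of G' - C with at least two vertices (the component of u, containing
-- another vertex v ≠ u) contains a vertex w heavy in G.
PcHeavy : ∀ {n} (i : ℕ) → Graph n → Set
PcHeavy i G = ∀ (p : Fin i → Fin _) → InducedPath i G p →
  ∀ (C : Fin i → Bool) → IsMaximalClique (λ j k → G (p j) (p k)) C →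
  ∀ u v → u ≢ v → Reach (λ j k → G (p j) (p k)) (not ∘ C) u v →
  ∃ λ w → Reach (λ j k → G (p j) (p k)) (not ∘ C) u w × Heavy G (p w)

completion : ∀ {n} → Graph n → Fin n → Graph n
completion G x u v = G u v ∨ (G x u ∧ G x v ∧ not ⌊ u ≟ v ⌋)

NbhdClique : ∀ {n} → Graph n → Fin n → Set
NbhdClique G x = IsClique G (G x)

GStarAdj : ∀ {n} → Graph n → Fin n → Fin n → Fin n → Set
GStarAdj G x u v = G u v ≡ true ⊎ (G x u ≡ true × G x v ≡ true × HeavyPair G u v)

GStarNbhdConnected : ∀ {n} → Graph n → Fin n → Set
GStarNbhdConnected G x = ∀ u v → G x u ≡ true → G x v ≡ true →
  ReachS u v
  where
  data ReachS : Fin _ → Fin _ → Set where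
    here : ∀ {u} → ReachS u u
    step : ∀ {u v w} → ReachS u v → GStarAdj G x v w → G x w ≡ true → ReachS u w

TwoCliquesCondition : ∀ {n} → Graph n → Fin n → Set
TwoCliquesCondition G x = Σ (Fin _ → Bool) λ C₁ → Σ (Fin _ → Bool) λ C₂ →
  (∀ v → G x v ≡ true ⇔ (C₁ v ≡ true ⊎ C₂ v ≡ true)) ×
  (∀ v → C₁ v ≡ true → C₂ v ≡ true → ⊥) ×
  (∀ u v → C₁ u ≡ true → C₁ v ≡ true → u ≢ v → GStarAdj G x u v) ×
  (∀ u v → C₂ u ≡ true → C₂ v ≡ true → u ≢ v → GStarAdj G x u v) ×
  (∀ u v → C₁ u ≡ true → C₂ v ≡ true → ¬ GStarAdj G x u v) ×
  (∃ λ z → HeavyPair G x z × ∃ λ y₁ → ∃ λ y₂ →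
     C₁ y₁ ≡ true × C₂ y₂ ≡ true × G z y₁ ≡ true × G z y₂ ≡ true)

CEligible : ∀ {n} → Graph n → Fin n → Set
CEligible G x = ¬ NbhdClique G x × (GStarNbhdConnected G x ⊎ TwoCliquesCondition G x)

module Submission where

-- The argument needs only that G is simple and
-- P_i-c-heavy and that i ≥ 2.
--
-- 1. Degrees grow from G to H, and a neighbour u of x has d_H(u) ≥ d_G(x), because
--    the closed neighbourhood N_G[x] lies in N_H[u] (module Completion).
-- 2. On an induced path the maximal cliques are the pairs {c, c+1} of consecutive
--    vertices, and the components of the rest are the segments [0, c) and [c+2, i).
--    So c-heaviness of a single path is equivalent to segment-heaviness: every
--    segment with two vertices has a heavy vertex (cheavy⇒segments, segments⇒cheavy).
-- 3. Let p be an induced P_i of H. If p is induced in G, its segments contain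
--    G-heavy, hence H-heavy, vertices. Otherwise some edge p_a p_{a+1} is new; then
--    p_a, p_{a+1} are the only neighbours of x on p, and inserting x between them gives
--    an induced path of G on i + 1 vertices (module Insertion). Its first and last i
--    vertices are induced P_i's of G, and their heavy segment vertices lead back to
--    heavy vertices in the corresponding segments of p (segments-from-windows).

open import Defs
open import Data.Nat using (ℕ; _≤_)
open import Data.Fin using (Fin)
open import Data.Nat using (zero; suc; _+_; _<_; z≤n; s≤s; s≤s⁻¹; _≤′_; ≤′-reflexive; ≤′-step)
open import Data.Nat using () renaming (_≟_ to _≟ℕ_)
open import Data.Nat.Properties hiding (_≟_)
open import Data.Fin using (toℕ; fromℕ<; _≟_) renaming (zero to fzero; suc to fsuc)
open import Data.Fin.Properties using (toℕ-injective; toℕ-fromℕ<; fromℕ<-toℕ; toℕ<n; any?)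
open import Data.Bool using (Bool; true; false; if_then_else_; _∨_; not)
open import Data.Bool.Properties using (∨-zeroʳ; ¬-not) renaming (_≟_ to _≟𝔹_)
open import Data.Product using (∃; ∃₂; _×_; _,_; proj₁; proj₂)
open import Data.Sum using (_⊎_; inj₁; inj₂)
open import Data.Empty using (⊥; ⊥-elim)
open import Relation.Nullary using (¬_; Dec; yes; no; contradiction)
open import Relation.Nullary.Decidable using (⌊_⌋; _×-dec_)
open import Relation.Binary.PropositionalEquality
open import Function using (_∘_; _⇔_; mk⇔; Equivalence)

countT-mono : ∀ {n} (f g : Fin n → Bool) → (∀ w → f w ≡ true → g w ≡ true) →
  countT f ≤ countT g
countT-mono {zero}  f g f⊆g = z≤n
countT-mono {suc n} f g f⊆g with f fzero in ef | g fzero in eg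
... | true  | true  = s≤s (countT-mono (f ∘ fsuc) (g ∘ fsuc) (f⊆g ∘ fsuc))
... | true  | false = contradiction (trans (sym (f⊆g fzero ef)) eg) λ ()
... | false | true  = m≤n⇒m≤1+n (countT-mono (f ∘ fsuc) (g ∘ fsuc) (f⊆g ∘ fsuc))
... | false | false = countT-mono (f ∘ fsuc) (g ∘ fsuc) (f⊆g ∘ fsuc)

countT-cong : ∀ {n} {f g : Fin n → Bool} → (∀ w → f w ≡ g w) → countT f ≡ countT g
countT-cong {zero}  f≗g = refl
countT-cong {suc n} f≗g =
  cong₂ _+_ (cong (λ b → if b then 1 else 0) (f≗g fzero)) (countT-cong (f≗g ∘ fsuc))

fsuc-≟ : ∀ {n} (w v : Fin n) → ⌊ fsuc w ≟ fsuc v ⌋ ≡ ⌊ w ≟ v ⌋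
fsuc-≟ w v with w ≟ v
... | yes _ = refl
... | no  _ = refl

countT-insert : ∀ {n} (f : Fin n → Bool) v → f v ≡ false →
  countT (λ w → ⌊ w ≟ v ⌋ ∨ f w) ≡ suc (countT f)
countT-insert {suc n} f fzero    fv rewrite fv = refl
countT-insert {suc n} f (fsuc v) fv = begin
  b + countT (λ w → ⌊ fsuc w ≟ fsuc v ⌋ ∨ f (fsuc w))
    ≡⟨ cong (b +_) (countT-cong (λ w → cong (_∨ f (fsuc w)) (fsuc-≟ w v))) ⟩
  b + countT (λ w → ⌊ w ≟ v ⌋ ∨ f (fsuc w))
    ≡⟨ cong (b +_) (countT-insert (f ∘ fsuc) v fv) ⟩
  b + suc (countT (f ∘ fsuc))
    ≡⟨ +-suc b _ ⟩
  suc (b + countT (f ∘ fsuc)) ∎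
  where
  open ≡-Reasoning
  b : ℕ
  b = if f fzero then 1 else 0

Adj : ℕ → ℕ → Set
Adj m m' = suc m ≡ m' ⊎ suc m' ≡ m

adj-sym : ∀ {m m'} → Adj m m' → Adj m' m
adj-sym (inj₁ e) = inj₂ e
adj-sym (inj₂ e) = inj₁ e

adj-suc : ∀ {m m'} → Adj m m' → Adj (suc m) (suc m')
adj-suc (inj₁ e) = inj₁ (cong suc e)
adj-suc (inj₂ e) = inj₂ (cong suc e)

adj-unsuc : ∀ {m m'} → Adj (suc m) (suc m') → Adj m m'
adj-unsuc (inj₁ e) = inj₁ (suc-injective e)
adj-unsuc (inj₂ e) = inj₂ (suc-injective e)

adj-irrefl : ∀ {m} → ¬ Adj m m
adj-irrefl (inj₁ e) = 1+n≢n e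
adj-irrefl (inj₂ e) = 1+n≢n e

adj-crossing : ∀ {a m m'} → m ≤ a → a < m' → Adj m m' → m ≡ a × m' ≡ suc a
adj-crossing m≤a a<m' (inj₁ refl) = m≡a , cong suc m≡a
  where m≡a = ≤-antisym m≤a (s≤s⁻¹ a<m')
adj-crossing m≤a a<m' (inj₂ refl) = ⊥-elim (<-irrefl refl (<-≤-trans a<m' (≤-trans (n≤1+n _) m≤a)))

adj-jump : ∀ {a m m'} → m ≤ a → a < m' → ¬ Adj m (suc m')
adj-jump m≤a a<m' (inj₁ e)    = <-irrefl refl (<-≤-trans a<m' (subst (_≤ _) (suc-injective e) m≤a))
adj-jump m≤a a<m' (inj₂ refl) =
  <-irrefl refl (<-≤-trans a<m' (≤-trans (n≤1+n _) (≤-trans (n≤1+n _) m≤a)))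

adj-consecutive : ∀ {k c} → Adj k c → Adj k (suc c) → ⊥
adj-consecutive (inj₁ refl) (inj₁ e) = 1+n≢n (sym (suc-injective e))
adj-consecutive {k} (inj₁ refl) (inj₂ e) = m≢1+n+m k {2} (sym e)
adj-consecutive (inj₂ refl) (inj₁ e) = 1+n≢n e
adj-consecutive (inj₂ refl) (inj₂ e) = 1+n≢n e

module Completion {n} (G : Graph n) (simple : IsSimple G) (x : Fin n) where

  H : Graph n
  H = completion G x

  ⊇-edge : ∀ {u w} → G u w ≡ true → H u w ≡ true
  ⊇-edge e rewrite e = refl

  nbhd-edge : ∀ {u w} → G x u ≡ true → G x w ≡ true → u ≢ w → H u w ≡ true
  nbhd-edge {u} {w} xu xw u≢w with u ≟ w
  ... | yes u≡w = contradiction u≡w u≢w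
  ... | no  _   rewrite xu | xw = ∨-zeroʳ (G u w)

  new-edge : ∀ {u w} → H u w ≡ true → G u w ≡ false → G x u ≡ true × G x w ≡ true
  new-edge {u} {w} h g rewrite g with G x u | G x w | h
  ... | true | true | _ = refl , refl

  H-irrefl : ∀ v → H v v ≡ false
  H-irrefl v rewrite IsSimple.irrefl simple v with v ≟ v | G x v
  ... | yes _   | true  = refl
  ... | yes _   | false = refl
  ... | no  v≢v | _     = contradiction refl v≢v

  deg-mono : ∀ v → deg G v ≤ deg H v
  deg-mono v = countT-mono (G v) (H v) (λ _ → ⊇-edge)

  -- For a neighbour u of x the closed neighbourhood N_G[x] lies inside N_H[u],
  -- so d_G(x) ≤ d_H(u).
  deg-neighbour : ∀ {u} → G x u ≡ true → deg G x ≤ deg H u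
  deg-neighbour {u} xu = s≤s⁻¹ (subst₂ _≤_
    (countT-insert (G x) x (IsSimple.irrefl simple x))
    (countT-insert (H u) u (H-irrefl u))
    (countT-mono _ _ closed⊆))
    where
    closed⊆ : ∀ w → ⌊ w ≟ x ⌋ ∨ G x w ≡ true → ⌊ w ≟ u ⌋ ∨ H u w ≡ true
    closed⊆ w e with w ≟ x | w ≟ u
    ... | _ | yes _ = refl
    ... | yes refl | no _ rewrite ⊇-edge (trans (IsSimple.sym simple u x) xu) = refl
    ... | no _ | no w≢u = nbhd-edge xu e (w≢u ∘ sym)

  heavy-mono : ∀ {v} → Heavy G v → Heavy H v
  heavy-mono {v} hv = ≤-trans hv (*-monoʳ-≤ 2 (deg-mono v))

  heavy-neighbour : ∀ {u} → G x u ≡ true → Heavy G x → Heavy H u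
  heavy-neighbour xu hx = ≤-trans hx (*-monoʳ-≤ 2 (deg-neighbour xu))

  NewEdge : ∀ {i} → (Fin i → Fin n) → Fin i → Fin i → Set
  NewEdge p j k = G (p j) (p k) ≡ false × H (p j) (p k) ≡ true

  new-edge? : ∀ {i} (p : Fin i → Fin n) j k → Dec (NewEdge p j k)
  new-edge? p j k = (G (p j) (p k) ≟𝔹 false) ×-dec (H (p j) (p k) ≟𝔹 true)

  induced-or-new-edge : ∀ {i} {p : Fin i → Fin n} → InducedPath i H p →
    InducedPath i G p ⊎ ∃₂ λ j k → suc (toℕ j) ≡ toℕ k × NewEdge p j k
  induced-or-new-edge {i} {p} (injective , adjacent) with any? (λ j → any? (new-edge? p j))
  ... | yes (j , k , g , h) with Equivalence.to (adjacent j k) h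
  ...   | inj₁ e = inj₂ (j , k , e , g , h)
  ...   | inj₂ e = inj₂ (k , j , e , trans (IsSimple.sym simple (p k) (p j)) g ,
                          Equivalence.from (adjacent k j) (adj-sym (Equivalence.to (adjacent j k) h)))
  induced-or-new-edge {i} {p} (injective , adjacent) | no none =
    inj₁ (injective , λ j k → mk⇔ (Equivalence.to (adjacent j k) ∘ ⊇-edge)
                                  (old j k ∘ Equivalence.from (adjacent j k)))
    where
    old : ∀ j k → H (p j) (p k) ≡ true → G (p j) (p k) ≡ true
    old j k h = ¬-not λ g → none (j , k , g , h)

module _ {m} {A : Fin m → Fin m → Bool} {T : Fin m → Bool} where

  reach-start : ∀ {u v} → Reach A T u v → T u ≡ true
  reach-start (here t)     = t
  reach-start (step r _ _) = reach-start r

  reach-trans : ∀ {u v w} → Reach A T u v → Reach A T v w → Reach A T u w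
  reach-trans r (here _)      = r
  reach-trans r (step r' e t) = step (reach-trans r r') e t

  reach-sym : (∀ j k → A j k ≡ true → A k j ≡ true) →
    ∀ {u v} → Reach A T u v → Reach A T v u
  reach-sym A-sym (here t) = here t
  reach-sym A-sym (step r e t) =
    reach-trans (step (here t) (A-sym _ _ e) (reach-start (reach-sym A-sym r)))
                (reach-sym A-sym r)

PathShaped : ∀ {i} → (Fin i → Fin i → Bool) → Set
PathShaped A = ∀ j k → (A j k ≡ true) ⇔ PathAdj j k

IsEdgeAt : ∀ {i} → (Fin i → Bool) → ℕ → Set
IsEdgeAt C c = ∀ k → (C k ≡ true) ⇔ (toℕ k ≡ c ⊎ toℕ k ≡ suc c)

edgeSet : ∀ {i} → ℕ → Fin i → Bool
edgeSet c k = ⌊ toℕ k ≟ℕ c ⌋ ∨ ⌊ toℕ k ≟ℕ suc c ⌋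

edgeSet-isEdgeAt : ∀ {i} c → IsEdgeAt (edgeSet {i} c) c
edgeSet-isEdgeAt c k = mk⇔ to from
  where
  to : edgeSet c k ≡ true → toℕ k ≡ c ⊎ toℕ k ≡ suc c
  to e with toℕ k ≟ℕ c | toℕ k ≟ℕ suc c
  ... | yes k≡c | _        = inj₁ k≡c
  ... | no _    | yes k≡sc = inj₂ k≡sc
  from : toℕ k ≡ c ⊎ toℕ k ≡ suc c → edgeSet c k ≡ true
  from (inj₁ k≡c)  rewrite ≟-diag k≡c  = refl
  from (inj₂ k≡sc) rewrite ≟-diag k≡sc = ∨-zeroʳ _

outside-edge : ∀ {i} {C : Fin i → Bool} {c} → IsEdgeAt C c →
  ∀ k → (not (C k) ≡ true) ⇔ (toℕ k ≢ c × toℕ k ≢ suc c)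
outside-edge {C = C} {c} isEdge k = mk⇔ to from
  where
  to : not (C k) ≡ true → toℕ k ≢ c × toℕ k ≢ suc c
  to t = (λ e → in-C (Equivalence.from (isEdge k) (inj₁ e)))
       , (λ e → in-C (Equivalence.from (isEdge k) (inj₂ e)))
    where
    in-C : C k ≡ true → ⊥
    in-C e = contradiction (trans (sym (cong not e)) t) λ ()
  from : toℕ k ≢ c × toℕ k ≢ suc c → not (C k) ≡ true
  from (≢c , ≢sc) with C k in e
  ... | false = refl
  ... | true with Equivalence.to (isEdge k) e
  ... | inj₁ k≡c  = contradiction k≡c ≢c
  ... | inj₂ k≡sc = contradiction k≡sc ≢sc

module Path {i} {A : Fin i → Fin i → Bool} (shaped : PathShaped A) where

  edge : ∀ {j k} → A j k ≡ true → Adj (toℕ j) (toℕ k)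
  edge {j} {k} = Equivalence.to (shaped j k)

  edge⁻¹ : ∀ {j k} → Adj (toℕ j) (toℕ k) → A j k ≡ true
  edge⁻¹ {j} {k} = Equivalence.from (shaped j k)

  A-sym : ∀ j k → A j k ≡ true → A k j ≡ true
  A-sym j k = edge⁻¹ ∘ adj-sym ∘ edge

  stays-below : ∀ {T c} → (∀ k → T k ≡ true → toℕ k ≢ c) →
    ∀ {u w} → Reach A T u w → toℕ u < c → toℕ w < c
  stays-below avoid (here _) u<c = u<c
  stays-below {c = c} avoid (step {w = w} r e t) u<c with edge e
  ... | inj₁ sv≡w = ≤∧≢⇒< (subst (_≤ c) sv≡w (stays-below avoid r u<c)) (avoid w t)
  ... | inj₂ sw≡v = <-trans (subst (toℕ w <_) sw≡v (n<1+n _)) (stays-below avoid r u<c)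

  stays-above : ∀ {T c} → (∀ k → T k ≡ true → toℕ k ≢ suc c) →
    ∀ {u w} → Reach A T u w → suc c < toℕ u → suc c < toℕ w
  stays-above avoid (here _) c<u = c<u
  stays-above {c = c} avoid (step {v} {w} r e t) c<u with edge e
  ... | inj₁ sv≡w = <-trans (stays-above avoid r c<u) (subst (toℕ v <_) sv≡w (n<1+n _))
  ... | inj₂ sw≡v = ≤∧≢⇒< (s≤s⁻¹ (subst (suc (suc c) ≤_) (sym sw≡v) (stays-above avoid r c<u)))
                          (avoid w t ∘ sym)

  interval-climb : ∀ {T lo hi} → (∀ k → lo ≤ toℕ k → toℕ k < hi → T k ≡ true) →
    ∀ {u w} → lo ≤ toℕ u → toℕ w < hi → toℕ u ≤ toℕ w → Reach A T u w
  interval-climb {T} {lo} {hi} T⊇ {u} {w} lo≤u w<hi u≤w =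
    subst (Reach A T u) (fromℕ<-toℕ w (toℕ<n w)) (go (≤⇒≤′ u≤w) (toℕ<n w) w<hi)
    where
    go : ∀ {m} → toℕ u ≤′ m → (m<i : m < i) → m < hi → Reach A T u (fromℕ< m<i)
    go (≤′-reflexive refl) m<i m<hi =
      subst (Reach A T u) (sym (fromℕ<-toℕ u m<i)) (here (T⊇ u lo≤u m<hi))
    go {suc m} (≤′-step u≤m) sm<i sm<hi =
      step (go u≤m m<i (<-trans (n<1+n m) sm<hi))
           (edge⁻¹ (inj₁ (trans (cong suc (toℕ-fromℕ< m<i)) (sym (toℕ-fromℕ< sm<i)))))
           (T⊇ _ lo≤sm (subst (_< hi) (sym (toℕ-fromℕ< sm<i)) sm<hi))
      where
      m<i : m < i
      m<i = <-trans (n<1+n m) sm<i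
      lo≤sm : lo ≤ toℕ (fromℕ< sm<i)
      lo≤sm = subst (lo ≤_) (sym (toℕ-fromℕ< sm<i)) (≤-trans lo≤u (≤-trans (≤′⇒≤ u≤m) (n≤1+n m)))

  interval-connected : ∀ {T lo hi} → (∀ k → lo ≤ toℕ k → toℕ k < hi → T k ≡ true) →
    ∀ {j k} → lo ≤ toℕ j → toℕ j < hi → lo ≤ toℕ k → toℕ k < hi → Reach A T j k
  interval-connected T⊇ {j} {k} lo≤j j<hi lo≤k k<hi with ≤-total (toℕ j) (toℕ k)
  ... | inj₁ j≤k = interval-climb T⊇ lo≤j k<hi j≤k
  ... | inj₂ k≤j = reach-sym A-sym (interval-climb T⊇ lo≤k j<hi k≤j)

  edge-maximal : ∀ {C c} → suc c < i → IsEdgeAt C c → IsMaximalClique A C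
  edge-maximal {C} {c} sc<i isEdge = clique , maximal
    where
    member : ∀ {k} → C k ≡ true → toℕ k ≡ c ⊎ toℕ k ≡ suc c
    member {k} = Equivalence.to (isEdge k)

    clique : IsClique A C
    clique j k cj ck j≢k with member cj | member ck
    ... | inj₁ j≡c  | inj₁ k≡c  = contradiction (toℕ-injective (trans j≡c (sym k≡c))) j≢k
    ... | inj₁ j≡c  | inj₂ k≡sc = edge⁻¹ (inj₁ (trans (cong suc j≡c) (sym k≡sc)))
    ... | inj₂ j≡sc | inj₁ k≡c  = edge⁻¹ (inj₂ (trans (cong suc k≡c) (sym j≡sc)))
    ... | inj₂ j≡sc | inj₂ k≡sc = contradiction (toℕ-injective (trans j≡sc (sym k≡sc))) j≢k

    -- a position k outside {c, c+1} is not adjacent to c + 1 if k + 1 = c,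
    -- and not adjacent to c otherwise
    maximal : ∀ k → C k ≡ false → ∃ λ j → C j ≡ true × A j k ≡ false
    maximal k ck with Equivalence.to (outside-edge isEdge k) (cong not ck) | suc (toℕ k) ≟ℕ c
    ... | k≢c , _ | yes sk≡c =
      fromℕ< sc<i , Equivalence.from (isEdge _) (inj₂ (toℕ-fromℕ< sc<i)) ,
      ¬-not (far ∘ subst (λ z → Adj z (toℕ k)) (toℕ-fromℕ< sc<i) ∘ edge)
      where
      far : ¬ Adj (suc c) (toℕ k)
      far (inj₁ e) = m≢1+n+m (toℕ k) {2} (sym (trans (cong (suc ∘ suc) sk≡c) e))
      far (inj₂ e) = k≢c (suc-injective e)
    ... | _ , k≢sc | no sk≢c =
      fromℕ< c<i , Equivalence.from (isEdge _) (inj₁ (toℕ-fromℕ< c<i)) ,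
      ¬-not (far ∘ subst (λ z → Adj z (toℕ k)) (toℕ-fromℕ< c<i) ∘ edge)
      where
      c<i : c < i
      c<i = <-trans (n<1+n c) sc<i
      far : ¬ Adj c (toℕ k)
      far (inj₁ e) = k≢sc (sym e)
      far (inj₂ e) = sk≢c e

  neighbour : 2 ≤ i → ∀ m → ∃ λ k → A m k ≡ true
  neighbour 2≤i m with toℕ m in m≡
  ... | zero  = fromℕ< 2≤i , edge⁻¹ (inj₁ (trans (cong suc m≡) (sym (toℕ-fromℕ< 2≤i))))
  ... | suc t = fromℕ< t<i , edge⁻¹ (inj₂ (trans (cong suc (toℕ-fromℕ< t<i)) (sym m≡)))
    where
    t<i : t < i
    t<i = <-trans (n<1+n t) (subst (_< i) m≡ (toℕ<n m))

  maximal-edge : 2 ≤ i → ∀ {C} → IsMaximalClique A C → ∃ λ c → suc c < i × IsEdgeAt C c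
  maximal-edge 2≤i {C} (clique , maximal) = edge-of consecutive
    where
    ConsecutiveMembers : Set
    ConsecutiveMembers = ∃₂ λ m₁ m₂ → C m₁ ≡ true × C m₂ ≡ true × suc (toℕ m₁) ≡ toℕ m₂

    orient : ∀ {m k} → C m ≡ true → C k ≡ true → A m k ≡ true → ConsecutiveMembers
    orient {m} {k} cm ck amk with edge amk
    ... | inj₁ e = m , k , cm , ck , e
    ... | inj₂ e = k , m , ck , cm , e

    some-member : ∃ λ m → C m ≡ true
    some-member with C (fromℕ< 2≤i) in c₁
    ... | true  = fromℕ< 2≤i , c₁
    ... | false = proj₁ (maximal _ c₁) , proj₁ (proj₂ (maximal _ c₁))

    -- a member m with a neighbour k: either k is a member, or maximality yields
    -- a member j ≠ m missing k, and then j, m are adjacent members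
    consecutive : ConsecutiveMembers
    consecutive with some-member
    ... | m , cm with neighbour 2≤i m
    ... | k , amk with C k in ck
    ... | true = orient cm ck amk
    ... | false with maximal k ck
    ... | j , cj , ajk with j ≟ m
    ... | yes refl = contradiction (trans (sym amk) ajk) λ ()
    ... | no j≢m   = orient cj cm (clique j m cj cm j≢m)

    -- no third member: it would be adjacent to two consecutive positions
    edge-of : ConsecutiveMembers → ∃ λ c → suc c < i × IsEdgeAt C c
    edge-of (m₁ , m₂ , c₁ , c₂ , e) =
      toℕ m₁ , subst (_< i) (sym e) (toℕ<n m₂) , λ k → mk⇔ (to k) (from k)
      where
      to : ∀ k → C k ≡ true → toℕ k ≡ toℕ m₁ ⊎ toℕ k ≡ suc (toℕ m₁)
      to k ck with k ≟ m₁ | k ≟ m₂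
      ... | yes refl | _        = inj₁ refl
      ... | no _     | yes refl = inj₂ (sym e)
      ... | no k≢m₁  | no k≢m₂  = ⊥-elim (adj-consecutive (edge (clique k m₁ ck c₁ k≢m₁))
                                    (subst (Adj (toℕ k)) (sym e) (edge (clique k m₂ ck c₂ k≢m₂))))
      from : ∀ k → toℕ k ≡ toℕ m₁ ⊎ toℕ k ≡ suc (toℕ m₁) → C k ≡ true
      from k (inj₁ k≡m₁) rewrite toℕ-injective k≡m₁ = c₁
      from k (inj₂ k≡sm₁) rewrite toℕ-injective (trans k≡sm₁ e) = c₂

two-in-interval : ∀ {i lo hi} {u v : Fin i} → u ≢ v →
  lo ≤ toℕ u → toℕ u < hi → lo ≤ toℕ v → toℕ v < hi → suc lo < hi
two-in-interval {lo = lo} {hi} {u} {v} u≢v lo≤u u<hi lo≤v v<hi with suc lo <? hi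
... | yes slo<hi = slo<hi
... | no  slo≮hi = contradiction (toℕ-injective (trans (at-lo lo≤u u<hi) (sym (at-lo lo≤v v<hi)))) u≢v
  where
  at-lo : ∀ {m} → lo ≤ m → m < hi → m ≡ lo
  at-lo lo≤m m<hi = ≤-antisym (s≤s⁻¹ (≤-trans m<hi (≮⇒≥ slo≮hi))) lo≤m

CHeavyPath : ∀ {i} → (Fin i → Fin i → Bool) → (Fin i → Set) → Set
CHeavyPath A h = ∀ C → IsMaximalClique A C → ∀ u v → u ≢ v → Reach A (not ∘ C) u v →
  ∃ λ w → Reach A (not ∘ C) u w × h w

-- The same condition phrased by positions: removing two consecutive positions c, c+1
-- leaves the segments [0, c) and [c+2, i); each of them with at least two
-- positions contains an h-vertex.
SegmentHeavy : ∀ {i} → (Fin i → Set) → Set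
SegmentHeavy {i} h = ∀ c → suc c < i →
  (2 ≤ c → ∃ λ w → toℕ w < c × h w) ×
  (suc (suc (suc c)) < i → ∃ λ w → suc c < toℕ w × h w)

segments-mono : ∀ {i} {h h' : Fin i → Set} → (∀ {w} → h w → h' w) →
  SegmentHeavy h → SegmentHeavy h'
segments-mono h⇒h' segments c sc<i =
  (λ 2≤c → let (w , w<c , hw) = proj₁ (segments c sc<i) 2≤c in w , w<c , h⇒h' hw) ,
  (λ 3c<i → let (w , c<w , hw) = proj₂ (segments c sc<i) 3c<i in w , c<w , h⇒h' hw)

below-apart : ∀ {c m} → m < c → m ≢ c × m ≢ suc c
below-apart m<c = <⇒≢ m<c , <⇒≢ (<-trans m<c (n<1+n _))

above-apart : ∀ {c m} → suc c < m → m ≢ c × m ≢ suc c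
above-apart sc<m = >⇒≢ (<-trans (n<1+n _) sc<m) , >⇒≢ sc<m

module _ {i} {A : Fin i → Fin i → Bool} (shaped : PathShaped A) {h : Fin i → Set} where
  open Path shaped

  private
    avoids-edge : ∀ {C : Fin i → Bool} {c} → IsEdgeAt C c →
      ∀ {lo hi} → (∀ {m} → lo ≤ m → m < hi → m ≢ c × m ≢ suc c) →
      ∀ k → lo ≤ toℕ k → toℕ k < hi → not (C k) ≡ true
    avoids-edge isEdge apart k lo≤k k<hi =
      Equivalence.from (outside-edge isEdge k) (apart lo≤k k<hi)

    avoids-c : ∀ {C : Fin i → Bool} {c} → IsEdgeAt C c → ∀ k → not (C k) ≡ true → toℕ k ≢ c
    avoids-c isEdge k = proj₁ ∘ Equivalence.to (outside-edge isEdge k)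

    avoids-sc : ∀ {C : Fin i → Bool} {c} → IsEdgeAt C c → ∀ k → not (C k) ≡ true → toℕ k ≢ suc c
    avoids-sc isEdge k = proj₂ ∘ Equivalence.to (outside-edge isEdge k)

  -- Apply c-heaviness to the maximal clique {c, c+1} and to the two lowest
  -- positions of the segment in question.
  cheavy⇒segments : CHeavyPath A h → SegmentHeavy h
  cheavy⇒segments cheavy c sc<i = left , right
    where
    isEdge = edgeSet-isEdgeAt {i} c
    component = cheavy (edgeSet c) (edge-maximal sc<i isEdge)

    left : 2 ≤ c → ∃ λ w → toℕ w < c × h w
    left 2≤c = w , stays-below (avoids-c isEdge) r u<c , hw
      where
      c<i = <-trans (n<1+n c) sc<i
      0<i = <-trans (s≤s z≤n) (<-trans 2≤c c<i)
      1<i = <-trans 2≤c c<i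
      u<c = subst (_< c) (sym (toℕ-fromℕ< 0<i)) (<-trans (s≤s z≤n) 2≤c)
      v<c = subst (_< c) (sym (toℕ-fromℕ< 1<i)) 2≤c
      u≢v : fromℕ< 0<i ≢ fromℕ< 1<i
      u≢v e = 0≢1+n (trans (sym (toℕ-fromℕ< 0<i)) (trans (cong toℕ e) (toℕ-fromℕ< 1<i)))
      result = component _ _ u≢v
        (interval-connected (avoids-edge isEdge λ _ → below-apart) z≤n u<c z≤n v<c)
      w = proj₁ result
      r = proj₁ (proj₂ result)
      hw = proj₂ (proj₂ result)

    right : suc (suc (suc c)) < i → ∃ λ w → suc c < toℕ w × h w
    right 3c<i = w , stays-above (avoids-sc isEdge) r sc<u , hw
      where
      2c<i = <-trans (n<1+n _) 3c<i
      sc<u = ≤-reflexive (sym (toℕ-fromℕ< 2c<i))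
      sc<v = subst (suc c <_) (sym (toℕ-fromℕ< 3c<i)) (n≤1+n _)
      u≢v : fromℕ< 2c<i ≢ fromℕ< 3c<i
      u≢v e = 1+n≢n (sym (trans (sym (toℕ-fromℕ< 2c<i)) (trans (cong toℕ e) (toℕ-fromℕ< 3c<i))))
      result = component _ _ u≢v
        (interval-connected (avoids-edge isEdge λ sc<m _ → above-apart sc<m)
          sc<u (toℕ<n _) sc<v (toℕ<n _))
      w = proj₁ result
      r = proj₁ (proj₂ result)
      hw = proj₂ (proj₂ result)

  -- A maximal clique is an edge {c, c+1}; a component with two vertices lies in one
  -- of the two segments, which is connected and contains an h-vertex.
  segments⇒cheavy : 2 ≤ i → SegmentHeavy h → CHeavyPath A h
  segments⇒cheavy 2≤i segments C maxC u v u≢v r with maximal-edge 2≤i maxC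
  ... | c , sc<i , isEdge with toℕ u <? c
  ... | yes u<c = w , interval-connected T⊇ z≤n u<c z≤n w<c , hw
    where
    T⊇ = avoids-edge isEdge λ _ → below-apart
    v<c = stays-below (avoids-c isEdge) r u<c
    heavy = proj₁ (segments c sc<i) (two-in-interval u≢v z≤n u<c z≤n v<c)
    w = proj₁ heavy
    w<c = proj₁ (proj₂ heavy)
    hw = proj₂ (proj₂ heavy)
  ... | no u≮c = w , interval-connected T⊇ sc<u (toℕ<n u) sc<w (toℕ<n w) , hw
    where
    T⊇ = avoids-edge isEdge λ sc<m _ → above-apart sc<m
    u-apart = Equivalence.to (outside-edge isEdge u) (reach-start r)
    sc<u : suc c < toℕ u
    sc<u = ≤∧≢⇒< (≤∧≢⇒< (≮⇒≥ u≮c) (proj₁ u-apart ∘ sym)) (proj₂ u-apart ∘ sym)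
    sc<v = stays-above (avoids-sc isEdge) r sc<u
    heavy = proj₂ (segments c sc<i) (two-in-interval u≢v sc<u (toℕ<n u) sc<v (toℕ<n v))
    w = proj₁ heavy
    sc<w = proj₁ (proj₂ heavy)
    hw = proj₂ (proj₂ heavy)

InducedPathℕ : ∀ {n} → ℕ → Graph n → (ℕ → Fin n) → Set
InducedPathℕ len G f =
  (∀ {m m'} → m < len → m' < len → f m ≡ f m' → m ≡ m') ×
  (∀ {m m'} → m < len → m' < len → (G (f m) (f m') ≡ true) ⇔ Adj m m')

inducedPath-toℕ : ∀ {n i} {G : Graph n} {f : ℕ → Fin n} →
  InducedPathℕ i G f → InducedPath i G (f ∘ toℕ)
inducedPath-toℕ (injective , adjacent) =
  (λ j k e → toℕ-injective (injective (toℕ<n j) (toℕ<n k) e)) ,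
  (λ j k → adjacent (toℕ<n j) (toℕ<n k))

window-init : ∀ {n len} {G : Graph n} {f : ℕ → Fin n} →
  InducedPathℕ (suc len) G f → InducedPathℕ len G f
window-init (injective , adjacent) =
  (λ h h' → injective (m≤n⇒m≤1+n h) (m≤n⇒m≤1+n h')) ,
  (λ h h' → adjacent (m≤n⇒m≤1+n h) (m≤n⇒m≤1+n h'))

window-tail : ∀ {n len} {G : Graph n} {f : ℕ → Fin n} →
  InducedPathℕ (suc len) G f → InducedPathℕ len G (f ∘ suc)
window-tail (injective , adjacent) =
  (λ h h' → suc-injective ∘ injective (s≤s h) (s≤s h')) ,
  (λ h h' → mk⇔ (adj-unsuc ∘ Equivalence.to (adjacent (s≤s h) (s≤s h')))
                (Equivalence.from (adjacent (s≤s h) (s≤s h')) ∘ adj-suc))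

extend : ∀ {i} {X : Set} → X → (Fin i → X) → ℕ → X
extend {i} d f m with m <? i
... | yes m<i = f (fromℕ< m<i)
... | no  _   = d

extend-< : ∀ {i} {X : Set} (d : X) (f : Fin i → X) {m} (m<i : m < i) →
  extend d f m ≡ f (fromℕ< m<i)
extend-< {i} d f {m} m<i with m <? i
... | yes m<i' = cong f (toℕ-injective (trans (toℕ-fromℕ< m<i') (sym (toℕ-fromℕ< m<i))))
... | no  m≮i  = contradiction m<i m≮i

extend-toℕ : ∀ {i} {X : Set} (d : X) (f : Fin i → X) (j : Fin i) → extend d f (toℕ j) ≡ f j
extend-toℕ d f j = trans (extend-< d f (toℕ<n j)) (cong f (fromℕ<-toℕ j (toℕ<n j)))

inducedPath-extend : ∀ {n i} {G : Graph n} {p : Fin i → Fin n} (d : Fin n) →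
  InducedPath i G p → InducedPathℕ i G (extend d p)
inducedPath-extend {G = G} {p} d (injective , adjacent) = injectiveℕ , adjacentℕ
  where
  injectiveℕ : ∀ {m m'} → m < _ → m' < _ → extend d p m ≡ extend d p m' → m ≡ m'
  injectiveℕ h h' e = trans (sym (toℕ-fromℕ< h)) (trans
    (cong toℕ (injective _ _ (trans (sym (extend-< d p h)) (trans e (extend-< d p h')))))
    (toℕ-fromℕ< h'))
  adjacentℕ : ∀ {m m'} → m < _ → m' < _ → (G (extend d p m) (extend d p m') ≡ true) ⇔ Adj m m'
  adjacentℕ {m} {m'} h h' =
    subst₂ (λ a b → (G (extend d p m) (extend d p m') ≡ true) ⇔ Adj a b)
      (toℕ-fromℕ< h) (toℕ-fromℕ< h')
      (subst₂ (λ u w → (G u w ≡ true) ⇔ PathAdj (fromℕ< h) (fromℕ< h'))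
        (sym (extend-< d p h)) (sym (extend-< d p h')) (adjacent _ _))

segments-from-windows : ∀ {i} {h : Fin i → Set} {g : ℕ → Set} →
  (∀ {m} → m < suc i → g m → ∃ λ b → toℕ b ≤ m × m ≤ suc (toℕ b) × h b) →
  SegmentHeavy {i} (g ∘ toℕ) → SegmentHeavy {i} (g ∘ suc ∘ toℕ) → SegmentHeavy h
segments-from-windows {i} {h} {g} back first last c sc<i = left , right
  where
  left : 2 ≤ c → ∃ λ w → toℕ w < c × h w
  left 2≤c with proj₁ (first c sc<i) 2≤c
  ... | w , w<c , gw with back (m≤n⇒m≤1+n (toℕ<n w)) gw
  ... | b , b≤w , _ , hb = b , ≤-<-trans b≤w w<c , hb

  right : suc (suc (suc c)) < i → ∃ λ w → suc c < toℕ w × h w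
  right 3c<i with proj₂ (last c sc<i) 3c<i
  ... | w , sc<w , gw with back (s≤s (toℕ<n w)) gw
  ... | b , _ , sw≤sb , hb = b , <-≤-trans sc<w (s≤s⁻¹ sw≤sb) , hb

-- Positions of the path obtained by inserting one new vertex between positions a and
-- a + 1 of a path: old positions m ≤ a, the new position a + 1, and old positions
-- m > a, which move to m + 1.
data Side (a : ℕ) : ℕ → Set where
  before   : ∀ {m} → m ≤ a → Side a m
  inserted : Side a (suc a)
  after    : ∀ {m} → a < m → Side a (suc m)

side : ∀ a m → Side a m
side zero    zero          = before z≤n
side zero    (suc zero)    = inserted
side zero    (suc (suc m)) = after (s≤s z≤n)
side (suc a) zero          = before z≤n
side (suc a) (suc m)       = shift (side a m)
  where
  shift : ∀ {a m} → Side a m → Side (suc a) (suc m)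
  shift (before m≤a) = before (s≤s m≤a)
  shift inserted     = inserted
  shift (after a<m)  = after (s≤s a<m)

module Insertion {n} (G : Graph n) (simple : IsSimple G) (x : Fin n)
  {i} (p : Fin i → Fin n) (ip : InducedPath i (completion G x) p)
  (j k : Fin i) (jk : suc (toℕ j) ≡ toℕ k)
  (missing : G (p j) (p k) ≡ false) (added : completion G x (p j) (p k) ≡ true) where

  open Completion G simple x

  P : ℕ → Fin n
  P = extend x p

  a : ℕ
  a = toℕ j

  path : InducedPathℕ i H P
  path = inducedPath-extend {G = H} x ip

  P-injective : ∀ {m m'} → m < i → m' < i → P m ≡ P m' → m ≡ m'
  P-injective = proj₁ path

  P-adj : ∀ {m m'} → m < i → m' < i → H (P m) (P m') ≡ true → Adj m m'
  P-adj h h' = Equivalence.to (proj₂ path h h')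

  P-adj⁻¹ : ∀ {m m'} → m < i → m' < i → Adj m m' → H (P m) (P m') ≡ true
  P-adj⁻¹ h h' = Equivalence.from (proj₂ path h h')

  G-sym : ∀ {u w} → G u w ≡ true → G w u ≡ true
  G-sym {u} {w} = trans (IsSimple.sym simple w u)

  a<i : a < i
  a<i = toℕ<n j

  sa<i : suc a < i
  sa<i = subst (_< i) (sym jk) (toℕ<n k)

  P-a : P a ≡ p j
  P-a = extend-toℕ x p j

  P-sa : P (suc a) ≡ p k
  P-sa = trans (cong P jk) (extend-toℕ x p k)

  G-missing : G (P a) (P (suc a)) ≡ false
  G-missing = subst₂ (λ u w → G u w ≡ false) (sym P-a) (sym P-sa) missing

  x-j : G x (p j) ≡ true
  x-j = proj₁ (new-edge added missing)

  x-a : G x (P a) ≡ true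
  x-a = subst (λ v → G x v ≡ true) (sym P-a) x-j

  x-sa : G x (P (suc a)) ≡ true
  x-sa = subst (λ v → G x v ≡ true) (sym P-sa) (proj₂ (new-edge added missing))

  -- x sees exactly the positions a and a + 1: any other neighbour would be adjacent
  -- in H to both of them
  x-neighbours : ∀ {m} → m < i → G x (P m) ≡ true → m ≡ a ⊎ m ≡ suc a
  x-neighbours {m} m<i xm with m ≟ℕ a | m ≟ℕ suc a
  ... | yes m≡a | _        = inj₁ m≡a
  ... | no _    | yes m≡sa = inj₂ m≡sa
  ... | no m≢a  | no m≢sa  = ⊥-elim (adj-consecutive
        (P-adj m<i a<i (nbhd-edge xm x-a (m≢a ∘ P-injective m<i a<i)))
        (P-adj m<i sa<i (nbhd-edge xm x-sa (m≢sa ∘ P-injective m<i sa<i))))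

  -- x is not on the path, for the same reason
  x-outside : ∀ {m} → m < i → P m ≢ x
  x-outside m<i Pm≡x = adj-consecutive
    (P-adj m<i a<i (⊇-edge (subst (λ v → G v (P a) ≡ true) (sym Pm≡x) x-a)))
    (P-adj m<i sa<i (⊇-edge (subst (λ v → G v (P (suc a)) ≡ true) (sym Pm≡x) x-sa)))

  -- Every edge of the path not crossing the cut between a and a + 1 is an edge of G:
  -- a new edge would join two neighbours of x, i.e. a and a + 1.
  SameSide : ℕ → ℕ → Set
  SameSide m m' = (m ≤ a × m' ≤ a) ⊎ (a < m × a < m')

  G-edge : ∀ {m m'} → m < i → m' < i → SameSide m m' → Adj m m' → G (P m) (P m') ≡ true
  G-edge {m} {m'} h h' same adj with G (P m) (P m') in g
  ... | true  = refl
  ... | false = ⊥-elim (adj-irrefl (subst (Adj m) (sym m≡m') adj))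
    where
    xm  = proj₁ (new-edge (P-adj⁻¹ h h' adj) g)
    xm' = proj₂ (new-edge (P-adj⁻¹ h h' adj) g)
    equal : m ≡ a ⊎ m ≡ suc a → m' ≡ a ⊎ m' ≡ suc a → SameSide m m' → m ≡ m'
    equal (inj₁ m≡a)  (inj₁ m'≡a)  _ = trans m≡a (sym m'≡a)
    equal (inj₂ m≡sa) (inj₂ m'≡sa) _ = trans m≡sa (sym m'≡sa)
    equal (inj₁ _)    (inj₂ refl)  (inj₁ (_ , sa≤a)) = ⊥-elim (<-irrefl refl sa≤a)
    equal (inj₁ refl) (inj₂ _)     (inj₂ (a<a , _))  = ⊥-elim (<-irrefl refl a<a)
    equal (inj₂ refl) (inj₁ _)     (inj₁ (sa≤a , _)) = ⊥-elim (<-irrefl refl sa≤a)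
    equal (inj₂ _)    (inj₁ refl)  (inj₂ (_ , a<a))  = ⊥-elim (<-irrefl refl a<a)
    m≡m' = equal (x-neighbours h xm) (x-neighbours h' xm') same

  vertexAt : ∀ {m} → Side a m → Fin n
  vertexAt (before {m} _) = P m
  vertexAt inserted       = x
  vertexAt (after {m} _)  = P m

  Q : ℕ → Fin n
  Q m = vertexAt (side a m)

  before-< : ∀ {m} → m ≤ a → m < i
  before-< m≤a = ≤-<-trans m≤a a<i

  after-< : ∀ {m} → suc m < suc i → m < i
  after-< = s≤s⁻¹

  swap : ∀ {u w m m'} → (G u w ≡ true) ⇔ Adj m m' → (G w u ≡ true) ⇔ Adj m' m
  swap uw⇔ = mk⇔ (adj-sym ∘ Equivalence.to uw⇔ ∘ G-sym) (G-sym ∘ Equivalence.from uw⇔ ∘ adj-sym)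

  before-x : ∀ {m} → m ≤ a → (G (P m) x ≡ true) ⇔ Adj m (suc a)
  before-x {m} m≤a = mk⇔ to from
    where
    to : G (P m) x ≡ true → Adj m (suc a)
    to g with x-neighbours (before-< m≤a) (G-sym g)
    ... | inj₁ m≡a  = inj₁ (cong suc m≡a)
    ... | inj₂ refl = ⊥-elim (<-irrefl refl m≤a)
    from : Adj m (suc a) → G (P m) x ≡ true
    from (inj₁ sm≡sa) rewrite suc-injective sm≡sa = G-sym x-a
    from (inj₂ refl)  = ⊥-elim (<-irrefl refl (≤-trans (n≤1+n _) m≤a))

  x-after : ∀ {m} → a < m → m < i → (G x (P m) ≡ true) ⇔ Adj (suc a) (suc m)
  x-after {m} a<m m<i = mk⇔ to from
    where
    to : G x (P m) ≡ true → Adj (suc a) (suc m)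
    to g with x-neighbours m<i g
    ... | inj₁ refl = ⊥-elim (<-irrefl refl a<m)
    ... | inj₂ m≡sa = inj₁ (cong suc (sym m≡sa))
    from : Adj (suc a) (suc m) → G x (P m) ≡ true
    from (inj₁ e) rewrite sym (suc-injective e) = x-sa
    from (inj₂ e) =
      ⊥-elim (<-irrefl refl (≤-trans a<m (≤-trans (n≤1+n _) (≤-reflexive (suc-injective e)))))

  before-after : ∀ {m m'} → m ≤ a → a < m' → m' < i → (G (P m) (P m') ≡ true) ⇔ Adj m (suc m')
  before-after {m} {m'} m≤a a<m' m'<i = mk⇔ to (⊥-elim ∘ adj-jump m≤a a<m')
    where
    -- the only H-edge across the cut is the new edge p_a p_{a+1}
    to : G (P m) (P m') ≡ true → Adj m (suc m')
    to g with adj-crossing m≤a a<m' (P-adj (before-< m≤a) m'<i (⊇-edge g))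
    ... | refl , refl = contradiction (trans (sym g) G-missing) λ ()

  vertexAt-adj : ∀ {m m'} (s : Side a m) (s' : Side a m') → m < suc i → m' < suc i →
    (G (vertexAt s) (vertexAt s') ≡ true) ⇔ Adj m m'
  vertexAt-adj (before h) (before h') _ _ = mk⇔
    (P-adj (before-< h) (before-< h') ∘ ⊇-edge) (G-edge (before-< h) (before-< h') (inj₁ (h , h')))
  vertexAt-adj (before h)  inserted    _ _   = before-x h
  vertexAt-adj (before h)  (after h')  _ hm' = before-after h h' (after-< hm')
  vertexAt-adj inserted    (before h') _ _   = swap (before-x h')
  vertexAt-adj inserted    inserted    _ _   =
    mk⇔ (λ g → contradiction (trans (sym g) (IsSimple.irrefl simple x)) λ ()) (⊥-elim ∘ adj-irrefl)
  vertexAt-adj inserted    (after h')  _ hm' = x-after h' (after-< hm')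
  vertexAt-adj (after h)   (before h') hm _  = swap (before-after h' h (after-< hm))
  vertexAt-adj (after h)   inserted    hm _  = swap (x-after h (after-< hm))
  vertexAt-adj (after h)   (after h')  hm hm' = mk⇔
    (adj-suc ∘ P-adj (after-< hm) (after-< hm') ∘ ⊇-edge)
    (G-edge (after-< hm) (after-< hm') (inj₂ (h , h')) ∘ adj-unsuc)

  vertexAt-injective : ∀ {m m'} (s : Side a m) (s' : Side a m') → m < suc i → m' < suc i →
    vertexAt s ≡ vertexAt s' → m ≡ m'
  vertexAt-injective (before h) (before h') _ _ e = P-injective (before-< h) (before-< h') e
  vertexAt-injective (before h) inserted    _ _ e = ⊥-elim (x-outside (before-< h) e)
  vertexAt-injective (before h) (after h')  _ hm' e =
    ⊥-elim (<-irrefl refl (<-≤-trans h' (subst (_≤ a) (P-injective (before-< h) (after-< hm') e) h)))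
  vertexAt-injective inserted (before h') _ _ e = ⊥-elim (x-outside (before-< h') (sym e))
  vertexAt-injective inserted inserted    _ _ _ = refl
  vertexAt-injective inserted (after h')  _ hm' e = ⊥-elim (x-outside (after-< hm') (sym e))
  vertexAt-injective (after h) (before h') hm _ e =
    ⊥-elim (<-irrefl refl (<-≤-trans h (subst (_≤ a) (P-injective (before-< h') (after-< hm) (sym e)) h')))
  vertexAt-injective (after h) inserted   hm _ e = ⊥-elim (x-outside (after-< hm) e)
  vertexAt-injective (after h) (after h') hm hm' e = cong suc (P-injective (after-< hm) (after-< hm') e)

  inserted-path : InducedPathℕ (suc i) G Q
  inserted-path = (λ h h' → vertexAt-injective (side a _) (side a _) h h')
                , (λ h h' → vertexAt-adj (side a _) (side a _) h h')

  heavy-at : ∀ {m} (m<i : m < i) → Heavy G (P m) → ∃ λ b → toℕ b ≡ m × Heavy H (p b)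
  heavy-at m<i hv =
    fromℕ< m<i , toℕ-fromℕ< m<i , heavy-mono (subst (Heavy G) (extend-< x p m<i) hv)

  -- A G-heavy vertex at position m of the new path yields an H-heavy vertex of p at
  -- position m or m - 1; for x this is p_a, since d_H(p_a) ≥ d_G(x).
  vertexAt-back : ∀ {m} (s : Side a m) → m < suc i → Heavy G (vertexAt s) →
    ∃ λ b → toℕ b ≤ m × m ≤ suc (toℕ b) × Heavy H (p b)
  vertexAt-back (before h) _ hv with heavy-at (before-< h) hv
  ... | b , b≡m , hb = b , ≤-reflexive b≡m , ≤-trans (≤-reflexive (sym b≡m)) (n≤1+n _) , hb
  vertexAt-back inserted _ hv = j , n≤1+n a , ≤-refl , heavy-neighbour x-j hv
  vertexAt-back (after h) hm hv with heavy-at (after-< hm) hv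
  ... | b , b≡m , hb =
    b , ≤-trans (≤-reflexive b≡m) (n≤1+n _) , ≤-reflexive (cong suc (sym b≡m)) , hb

  -- Consequently, if G is P_i-c-heavy then p is segment-heavy for H-heavy vertices:
  -- both windows of the new path are induced P_i's of G.
  segments : PcHeavy i G → SegmentHeavy (λ w → Heavy H (p w))
  segments pc = segments-from-windows (vertexAt-back (side a _))
    (cheavy⇒segments (proj₂ first) (pc (Q ∘ toℕ) first))
    (cheavy⇒segments (proj₂ last) (pc (Q ∘ suc ∘ toℕ) last))
    where
    first : InducedPath i G (Q ∘ toℕ)
    first = inducedPath-toℕ {G = G} (window-init {G = G} inserted-path)
    last : InducedPath i G (Q ∘ suc ∘ toℕ)
    last = inducedPath-toℕ {G = G} (window-tail {G = G} inserted-path)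

theorem12 : ∀ (i : ℕ) → 4 ≤ i → ∀ {n} (G : Graph n) → IsSimple G →
    ClawOHeavy G → PcHeavy i G → ∀ (x : Fin n) → CEligible G x →
    PcHeavy i (completion G x)
theorem12 i 4≤i G simple _ pc x _ p ip = segments⇒cheavy (proj₂ ip) 2≤i segments
  where
  open Completion G simple x

  2≤i : 2 ≤ i
  2≤i = ≤-trans (s≤s (s≤s z≤n)) 4≤i

  segments : SegmentHeavy (λ w → Heavy H (p w))
  segments with induced-or-new-edge ip
  ... | inj₁ ipG = segments-mono heavy-mono (cheavy⇒segments (proj₂ ipG) (pc p ipG))
  ... | inj₂ (j , k , jk , missing , added) = Insertion.segments G simple x p ip j k jk missing added pc
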